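{- Suppose $P_8(\mathbf{x})=0$, where $P_8(\mathbf{x})=\sum_{u_i\text{ non-leaf of }\mathcal{T}}\sum_{\text{tree }v_j}\big(x_{i,j}x_{i,j_1}-2x_{i,j}\hat z_{i,2j}-2x_{i,j_1}\hat z_{i,2j}+3\hat z_{i,2j}+x_{i,j}x_{i,j_2}-2x_{i,j}\hat z_{i,2j+1}-2x_{i,j_2}\hat z_{i,2j+1}+3\hat z_{i,2j+1}\big)$. Let $P_9(\mathbf{x})=\sum_{i=0}^{n_{\mathcal{T}}-1}\sum_{l\ne i}f(u_i,u_l)\sum_{\text{tree }v_j}\big(\hat z_{i,2j}x_{l,j_2}+\hat z_{i,2j+1}x_{l,j_1}\big)$. Then $P_9(\mathbf{x})=0$ if and only if there do not exist a tree vertex $v_j$ of $\mathcal{N}$ and an edge $(u_i,u_l)\in E(\mathcal{T})$ such that either $\{v_j,v_{j_1}\}\subseteq d(\mathbf{x},u_i)$ and $v_{j_2}\in d(\mathbf{x},u_l)$, or $\{v_j,v_{j_2}\}\subseteq d(\mathbf{x},u_i)$ and $v_{j_1}\in d(\mathbf{x},u_l)$.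
   Context: $\mathcal{N}$ is a rooted binary phylogenetic network on a finite set $X$ with vertices $v_0,\dots,v_{n_{\mathcal{N}}-1}$, and $\mathcal{T}$ is a rooted binary phylogenetic $X$-tree with vertices $u_0,\dots,u_{n_{\mathcal{T}}-1}$. A tree vertex has out-degree 2, and its children are $v_{j_1}$ and $v_{j_2}$ (in a fixed order). Sums over "tree $v_j$" range over indices $j$ with $v_j$ a tree vertex. $f(u_i,u_l)=1$ if $(u_i,u_l)\in E(\mathcal{T})$ and $0$ otherwise. The variables $x_{i,j}$, $\hat z_{i,2j}$ and $\hat z_{i,2j+1}$ are binary (the hatted ones defined for non-leaf $u_i$ and tree vertices $v_j$), and $\mathbf{x}$ is the vector of them. $d(\mathbf{x},u_i)=\{v_j:x_{i,j}=1\}$. -}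

module Defs where

open import Data.Nat as ℕ using (ℕ; zero; suc)
open import Data.Fin using (Fin; zero; suc; toℕ)
open import Data.Bool using (Bool; true; false; if_then_else_)
open import Data.Integer as Int using (ℤ)
open import Data.Product using (_×_; Σ; ∃)
open import Data.Sum using (_⊎_)
open import Relation.Nullary using (¬_; Dec; does)
open import Relation.Binary.PropositionalEquality using (_≡_; _≢_)
open import Relation.Binary.Construct.Closure.Transitive using (TransClosure)
open import Relation.Binary.Construct.Closure.ReflexiveTransitive using (Star)

∑ : (n : ℕ) → (Fin n → ℤ) → ℤ
∑ zero    f = Int.0ℤ
∑ (suc n) f = f zero Int.+ ∑ n (λ k → f (suc k))

count : (n : ℕ) → (Fin n → Bool) → ℕ
count zero    p = 0
count (suc n) p = (if p zero then 1 else 0) ℕ.+ count n (λ k → p (suc k))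

∑[_∣_] : (n : ℕ) → {P : Fin n → Set} → ((k : Fin n) → Dec (P k)) → (Fin n → ℤ) → ℤ
∑[ n ∣ P? ] f = ∑ n (λ k → if does (P? k) then f k else Int.0ℤ)

module _ {n : ℕ} (adj : Fin n → Fin n → Bool) where
  Edge : Fin n → Fin n → Set
  Edge a b = adj a b ≡ true

  indeg outdeg : Fin n → ℕ
  indeg  v = count n (λ w → adj w v)
  outdeg v = count n (λ w → adj v w)

-- A rooted binary phylogenetic network on X = Fin m, with vertices v₀,…,v_{n-1}.
-- Children of tree vertices are given in a fixed order (child₁, child₂).
record BinaryNetwork (m : ℕ) : Set where
  field
    n       : ℕ
    adj     : Fin n → Fin n → Bool
    root    : Fin n
    root-in : indeg adj root ≡ 0
    root-out : outdeg adj root ≡ 1 ⊎ outdeg adj root ≡ 2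
    nonroot : ∀ v → v ≢ root →
                (indeg adj v ≡ 1 × outdeg adj v ≡ 0)      -- leaf
              ⊎ (indeg adj v ≡ 1 × outdeg adj v ≡ 2)      -- tree vertex
              ⊎ (indeg adj v ≡ 2 × outdeg adj v ≡ 1)      -- reticulation
    acyclic : ∀ v → ¬ TransClosure (Edge adj) v v
    rooted  : ∀ v → Star (Edge adj) root v
    label   : Fin m → Fin n
    label-inj  : ∀ x y → label x ≡ label y → x ≡ y
    label-leaf : ∀ x → outdeg adj (label x) ≡ 0
    leaf-label : ∀ v → outdeg adj v ≡ 0 → ∃ λ x → label x ≡ v
    child₁ child₂ : Fin n → Fin n
    child-edge₁ : ∀ v → outdeg adj v ≡ 2 → Edge adj v (child₁ v)
    child-edge₂ : ∀ v → outdeg adj v ≡ 2 → Edge adj v (child₂ v)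
    child-dist  : ∀ v → outdeg adj v ≡ 2 → child₁ v ≢ child₂ v

  TreeV : Fin n → Set
  TreeV v = outdeg adj v ≡ 2

  treeV? : (v : Fin n) → Dec (TreeV v)
  treeV? v = outdeg adj v ℕ.≟ 2

  NonLeaf : Fin n → Set
  NonLeaf v = outdeg adj v ≢ 0

  nonLeaf? : (v : Fin n) → Dec (NonLeaf v)
  nonLeaf? v = Relation.Nullary.¬? (outdeg adj v ℕ.≟ 0)

record BinaryTree (m : ℕ) : Set where
  field
    net : BinaryNetwork m
  open BinaryNetwork net public
  field
    no-retic : ∀ v → indeg adj v ≢ 2

open import Data.Fin.Properties using () renaming (_≟_ to _≟ᶠ_)

module Penalties {m : ℕ} (N : BinaryNetwork m) (T : BinaryTree m) where
  private
    module N = BinaryNetwork N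
    module T = BinaryTree T
  open Int using (_+_; _-_; _*_)

  f : Fin T.n → Fin T.n → ℤ
  f i l = if T.adj i l then Int.1ℤ else Int.0ℤ

  ev od : Fin N.n → ℕ
  ev j = 2 ℕ.* toℕ j
  od j = suc (2 ℕ.* toℕ j)

  P₈ : (x : Fin T.n → Fin N.n → ℤ) (ẑ : Fin T.n → ℕ → ℤ) → ℤ
  P₈ x ẑ = ∑[ T.n ∣ T.nonLeaf? ] λ i → ∑[ N.n ∣ N.treeV? ] λ j →
    let j₁ = N.child₁ j ; j₂ = N.child₂ j in
      x i j * x i j₁ - Int.+ 2 * x i j * ẑ i (ev j) - Int.+ 2 * x i j₁ * ẑ i (ev j) + Int.+ 3 * ẑ i (ev j)
    + x i j * x i j₂ - Int.+ 2 * x i j * ẑ i (od j) - Int.+ 2 * x i j₂ * ẑ i (od j) + Int.+ 3 * ẑ i (od j)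

  P₉ : (x : Fin T.n → Fin N.n → ℤ) (ẑ : Fin T.n → ℕ → ℤ) → ℤ
  P₉ x ẑ = ∑ T.n λ i → ∑[ T.n ∣ (λ l → Relation.Nullary.¬? (l ≟ᶠ i)) ] λ l →
    f i l * (∑[ N.n ∣ N.treeV? ] λ j →
      ẑ i (ev j) * x l (N.child₂ j) + ẑ i (od j) * x l (N.child₁ j))

  d : (x : Fin T.n → Fin N.n → ℤ) → Fin T.n → Fin N.n → Set
  d x i j = x i j ≡ Int.1ℤ

  Binary : ℤ → Set
  Binary a = a ≡ Int.0ℤ ⊎ a ≡ Int.1ℤ

-- Each summand of P₈ is a sum of two penalties a b − 2 a z − 2 b z + 3 z, which on
-- 0/1 values is non-negative and vanishes exactly when z = a b.  Hence P₈ = 0 forces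
-- ẑ_{i,2j} = x_{i,j} x_{i,j₁} and ẑ_{i,2j+1} = x_{i,j} x_{i,j₂}.  P₉ is then a sum of
-- non-negative products of three bits, one for each edge (u_i, u_l) (never a loop, by
-- acyclicity) and tree vertex v_j, and a product of bits vanishes iff some factor does.
module Submission where

open import Defs
open import Data.Nat using (ℕ)
open import Data.Fin using (Fin)
open import Data.Integer using (ℤ; 0ℤ)
open import Data.Product using (_×_; ∃; ∃-syntax)
open import Data.Sum using (_⊎_)
open import Relation.Nullary using (¬_)
open import Relation.Binary.PropositionalEquality using (_≡_)
open import Function.Bundles using (_⇔_)

open import Data.Nat using (zero; suc; z≤n)
open import Data.Fin using (zero; suc)
open import Data.Bool using (Bool; true; false; if_then_else_)
open import Data.Empty using (⊥-elim)
open import Data.Product using (_,_; proj₁; proj₂)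
open import Data.Sum using (inj₁; inj₂)
open import Data.Product.Function.NonDependent.Propositional using (_×-⇔_)
open import Function.Base using (_∘_)
open import Function.Bundles using (mk⇔; Equivalence)
import Function.Properties.Equivalence as ⇔
open import Relation.Nullary using (Dec; yes; no; does; ¬?; _¬-⊎_)
open import Relation.Binary.PropositionalEquality using (_≢_; refl; sym; trans; subst; cong; cong₂)
open import Relation.Binary.Construct.Closure.Transitive using ([_])
open import Data.Integer using (+_; 1ℤ; _+_; _-_; _*_; _≤_; +≤+)
import Data.Integer.Properties as ℤ
open import Data.Integer.Tactic.RingSolver using (solve-∀)
import Data.Nat.Properties as ℕ
open import Data.Fin.Properties using () renaming (_≟_ to _≟ᶠ_)

open Equivalence using (to; from)

count≢0 : ∀ n (p : Fin n → Bool) k → p k ≡ true → count n p ≢ 0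
count≢0 (suc n) p zero    pk≡true c with p zero
count≢0 (suc n) p zero    ()      c | false
count≢0 (suc n) p zero    pk≡true () | true
count≢0 (suc n) p (suc k) pk≡true c =
  count≢0 n (p ∘ suc) k pk≡true (ℕ.m+n≡0⇒n≡0 (if p zero then 1 else 0) c)

+-nonneg : ∀ {a b} → 0ℤ ≤ a → 0ℤ ≤ b → 0ℤ ≤ a + b
+-nonneg = ℤ.+-mono-≤

+≡0⇔ : ∀ {a b} → 0ℤ ≤ a → 0ℤ ≤ b → a + b ≡ 0ℤ ⇔ (a ≡ 0ℤ × b ≡ 0ℤ)
+≡0⇔ (+≤+ {n = m} _) (+≤+ {n = n} _) = mk⇔ split (λ { (refl , refl) → refl })
  where
  split : + m + + n ≡ 0ℤ → + m ≡ 0ℤ × + n ≡ 0ℤ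
  split e = let m+n≡0 = ℤ.+-injective e in
    cong +_ (ℕ.m+n≡0⇒m≡0 m m+n≡0) , cong +_ (ℕ.m+n≡0⇒n≡0 m m+n≡0)

∑-nonneg : ∀ n {g : Fin n → ℤ} → (∀ k → 0ℤ ≤ g k) → 0ℤ ≤ ∑ n g
∑-nonneg zero    g≥0 = +≤+ z≤n
∑-nonneg (suc n) g≥0 = +-nonneg (g≥0 zero) (∑-nonneg n (g≥0 ∘ suc))

∑≡0⇔ : ∀ n {g : Fin n → ℤ} → (∀ k → 0ℤ ≤ g k) → ∑ n g ≡ 0ℤ ⇔ (∀ k → g k ≡ 0ℤ)
∑≡0⇔ zero    g≥0 = mk⇔ (λ _ ()) (λ _ → refl)
∑≡0⇔ (suc n) {g} g≥0 = mk⇔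
  (λ s≡0 → let head≡0 , tail≡0 = to (+≡0⇔ (g≥0 zero) tail≥0) s≡0 in
     λ { zero → head≡0 ; (suc k) → to (∑≡0⇔ n (g≥0 ∘ suc)) tail≡0 k })
  (λ g≡0 → from (+≡0⇔ (g≥0 zero) tail≥0) (g≡0 zero , from (∑≡0⇔ n (g≥0 ∘ suc)) (g≡0 ∘ suc)))
  where
  tail≥0 : 0ℤ ≤ ∑ n (g ∘ suc)
  tail≥0 = ∑-nonneg n (g≥0 ∘ suc)

∑-cong : ∀ n {g h : Fin n → ℤ} → (∀ k → g k ≡ h k) → ∑ n g ≡ ∑ n h
∑-cong zero    g≡h = refl
∑-cong (suc n) g≡h = cong₂ _+_ (g≡h zero) (∑-cong n (g≡h ∘ suc))

module _ {n : ℕ} {P : Fin n → Set} (P? : (k : Fin n) → Dec (P k)) {g : Fin n → ℤ} where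

  private
    restricted : Fin n → ℤ
    restricted k = if does (P? k) then g k else 0ℤ

    restricted-nonneg : (∀ k → P k → 0ℤ ≤ g k) → ∀ k → 0ℤ ≤ restricted k
    restricted-nonneg g≥0 k with P? k
    ... | yes p = g≥0 k p
    ... | no _  = +≤+ z≤n

    restricted≡0⇔ : ∀ k → restricted k ≡ 0ℤ ⇔ (P k → g k ≡ 0ℤ)
    restricted≡0⇔ k with P? k
    ... | yes p  = mk⇔ (λ g≡0 _ → g≡0) (λ g≡0 → g≡0 p)
    ... | no ¬p  = mk⇔ (λ _ p → ⊥-elim (¬p p)) (λ _ → refl)

  ∑[]-nonneg : (∀ k → P k → 0ℤ ≤ g k) → 0ℤ ≤ ∑[ n ∣ P? ] g
  ∑[]-nonneg g≥0 = ∑-nonneg n (restricted-nonneg g≥0)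

  ∑[]≡0⇔ : (∀ k → P k → 0ℤ ≤ g k) → ∑[ n ∣ P? ] g ≡ 0ℤ ⇔ (∀ k → P k → g k ≡ 0ℤ)
  ∑[]≡0⇔ g≥0 = ⇔.trans (∑≡0⇔ n (restricted-nonneg g≥0))
    (mk⇔ (λ h k → to (restricted≡0⇔ k) (h k)) (λ h k → from (restricted≡0⇔ k) (h k)))

∑[]-cong : ∀ {n} {P : Fin n → Set} (P? : (k : Fin n) → Dec (P k)) {g h : Fin n → ℤ} →
           (∀ k → g k ≡ h k) → ∑[ n ∣ P? ] g ≡ ∑[ n ∣ P? ] h
∑[]-cong {n} P? g≡h = ∑-cong n λ k → cong (λ v → if does (P? k) then v else 0ℤ) (g≡h k)

indicator-*-nonneg : ∀ b {y} → (b ≡ true → 0ℤ ≤ y) → 0ℤ ≤ (if b then 1ℤ else 0ℤ) * y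
indicator-*-nonneg false   y≥0 = +≤+ z≤n
indicator-*-nonneg true {y} y≥0 = subst (0ℤ ≤_) (sym (ℤ.*-identityˡ y)) (y≥0 refl)

indicator-*≡0⇔ : ∀ b y → (if b then 1ℤ else 0ℤ) * y ≡ 0ℤ ⇔ (b ≡ true → y ≡ 0ℤ)
indicator-*≡0⇔ false y = mk⇔ (λ _ ()) (λ _ → refl)
indicator-*≡0⇔ true  y = mk⇔ (λ e _ → trans (sym (ℤ.*-identityˡ y)) e)
                             (λ h → trans (ℤ.*-identityˡ y) (h refl))

¬×¬⇔¬⊎ : ∀ {A B : Set} → (¬ A × ¬ B) ⇔ (¬ (A ⊎ B))
¬×¬⇔¬⊎ = mk⇔ (λ (¬a , ¬b) → ¬a ¬-⊎ ¬b) (λ ¬a⊎b → ¬a⊎b ∘ inj₁ , ¬a⊎b ∘ inj₂)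

-- Penalties.Binary, restated because that module is parametrised by a network and a tree.
Bit : ℤ → Set
Bit a = a ≡ 0ℤ ⊎ a ≡ 1ℤ

bit-nonneg : ∀ {a} → Bit a → 0ℤ ≤ a
bit-nonneg (inj₁ refl) = +≤+ z≤n
bit-nonneg (inj₂ refl) = +≤+ z≤n

bit-* : ∀ {a b} → Bit a → Bit b → Bit (a * b)
bit-* (inj₁ refl) _           = inj₁ refl
bit-* (inj₂ refl) (inj₁ refl) = inj₁ refl
bit-* (inj₂ refl) (inj₂ refl) = inj₂ refl

bit-*-*≡0⇔ : ∀ {a b c} → Bit a → Bit b → Bit c →
             a * b * c ≡ 0ℤ ⇔ (¬ (a ≡ 1ℤ × b ≡ 1ℤ × c ≡ 1ℤ))
bit-*-*≡0⇔ p q r = mk⇔ (λ { e (refl , refl , refl) → 1≢0 e }) (≡0 p q r)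
  where
  1≢0 : 1ℤ ≢ 0ℤ
  1≢0 ()
  ≡0 : ∀ {a b c} → Bit a → Bit b → Bit c → ¬ (a ≡ 1ℤ × b ≡ 1ℤ × c ≡ 1ℤ) → a * b * c ≡ 0ℤ
  ≡0 (inj₁ refl) _           _           _ = refl
  ≡0 (inj₂ refl) (inj₁ refl) _           _ = refl
  ≡0 (inj₂ refl) (inj₂ refl) (inj₁ refl) _ = refl
  ≡0 (inj₂ refl) (inj₂ refl) (inj₂ refl) h = ⊥-elim (h (refl , refl , refl))

andPenalty : ℤ → ℤ → ℤ → ℤ
andPenalty a b z = a * b - + 2 * a * z - + 2 * b * z + + 3 * z

andPenalty-nonneg : ∀ {a b z} → Bit a → Bit b → Bit z → 0ℤ ≤ andPenalty a b z
andPenalty-nonneg (inj₁ refl) (inj₁ refl) (inj₁ refl) = +≤+ z≤n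
andPenalty-nonneg (inj₁ refl) (inj₁ refl) (inj₂ refl) = +≤+ z≤n
andPenalty-nonneg (inj₁ refl) (inj₂ refl) (inj₁ refl) = +≤+ z≤n
andPenalty-nonneg (inj₁ refl) (inj₂ refl) (inj₂ refl) = +≤+ z≤n
andPenalty-nonneg (inj₂ refl) (inj₁ refl) (inj₁ refl) = +≤+ z≤n
andPenalty-nonneg (inj₂ refl) (inj₁ refl) (inj₂ refl) = +≤+ z≤n
andPenalty-nonneg (inj₂ refl) (inj₂ refl) (inj₁ refl) = +≤+ z≤n
andPenalty-nonneg (inj₂ refl) (inj₂ refl) (inj₂ refl) = +≤+ z≤n

andPenalty≡0⇒≡* : ∀ {a b z} → Bit a → Bit b → Bit z → andPenalty a b z ≡ 0ℤ → z ≡ a * b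
andPenalty≡0⇒≡* (inj₁ refl) (inj₁ refl) (inj₁ refl) _  = refl
andPenalty≡0⇒≡* (inj₁ refl) (inj₁ refl) (inj₂ refl) ()
andPenalty≡0⇒≡* (inj₁ refl) (inj₂ refl) (inj₁ refl) _  = refl
andPenalty≡0⇒≡* (inj₁ refl) (inj₂ refl) (inj₂ refl) ()
andPenalty≡0⇒≡* (inj₂ refl) (inj₁ refl) (inj₁ refl) _  = refl
andPenalty≡0⇒≡* (inj₂ refl) (inj₁ refl) (inj₂ refl) ()
andPenalty≡0⇒≡* (inj₂ refl) (inj₂ refl) (inj₁ refl) ()
andPenalty≡0⇒≡* (inj₂ refl) (inj₂ refl) (inj₂ refl) _  = refl

+-reassoc : ∀ s {a b c d} → s + a - b - c + d ≡ s + (a - b - c + d)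
+-reassoc s {a} {b} {c} {d} = reassoc s a b c d
  where
  reassoc : ∀ s a b c d → s + a - b - c + d ≡ s + (a - b - c + d)
  reassoc = solve-∀

module _ {m : ℕ} (N : BinaryNetwork m) (T : BinaryTree m) where
  private
    module N = BinaryNetwork N
    module T = BinaryTree T
  open Penalties N T

  edge⇒nonLeaf : ∀ {i l} → Edge T.adj i l → T.NonLeaf i
  edge⇒nonLeaf {i} {l} = count≢0 T.n (T.adj i) l

  edge⇒≢ : ∀ {i l} → Edge T.adj i l → l ≢ i
  edge⇒≢ {i} e refl = T.acyclic i [ e ]

  Conflict : (Fin T.n → Fin N.n → ℤ) → Fin T.n → Fin T.n → Fin N.n → Set
  Conflict x i l j = (d x i j × d x i (N.child₁ j) × d x l (N.child₂ j))
                   ⊎ (d x i j × d x i (N.child₂ j) × d x l (N.child₁ j))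

  module _ (x : Fin T.n → Fin N.n → ℤ) (ẑ : Fin T.n → ℕ → ℤ)
           (x-bit : ∀ i j → Binary (x i j))
           (ẑ-bit : ∀ i j → T.NonLeaf i → N.TreeV j → Binary (ẑ i (ev j)) × Binary (ẑ i (od j)))
           where

    andPenalties : Fin T.n → Fin N.n → ℤ
    andPenalties i j = andPenalty (x i j) (x i (N.child₁ j)) (ẑ i (ev j))
                     + andPenalty (x i j) (x i (N.child₂ j)) (ẑ i (od j))

    P₈≡∑andPenalties : P₈ x ẑ ≡ ∑[ T.n ∣ T.nonLeaf? ] λ i → ∑[ N.n ∣ N.treeV? ] (andPenalties i)
    P₈≡∑andPenalties = ∑[]-cong T.nonLeaf? λ i → ∑[]-cong N.treeV? λ j →
      +-reassoc (andPenalty (x i j) (x i (N.child₁ j)) (ẑ i (ev j)))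

    penalties-nonneg : ∀ i j → T.NonLeaf i → N.TreeV j →
                       0ℤ ≤ andPenalty (x i j) (x i (N.child₁ j)) (ẑ i (ev j))
                     × 0ℤ ≤ andPenalty (x i j) (x i (N.child₂ j)) (ẑ i (od j))
    penalties-nonneg i j nl tv =
      andPenalty-nonneg (x-bit i j) (x-bit i _) (proj₁ (ẑ-bit i j nl tv)) ,
      andPenalty-nonneg (x-bit i j) (x-bit i _) (proj₂ (ẑ-bit i j nl tv))

    andPenalties-nonneg : ∀ i → T.NonLeaf i → ∀ j → N.TreeV j → 0ℤ ≤ andPenalties i j
    andPenalties-nonneg i nl j tv = let p , q = penalties-nonneg i j nl tv in +-nonneg p q

    P₈≡0⇒ẑ≡* : P₈ x ẑ ≡ 0ℤ → ∀ {i j} → T.NonLeaf i → N.TreeV j →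
               ẑ i (ev j) ≡ x i j * x i (N.child₁ j) × ẑ i (od j) ≡ x i j * x i (N.child₂ j)
    P₈≡0⇒ẑ≡* P₈≡0 {i} {j} nl tv =
      andPenalty≡0⇒≡* (x-bit i j) (x-bit i _) (proj₁ (ẑ-bit i j nl tv)) (proj₁ penalties≡0) ,
      andPenalty≡0⇒≡* (x-bit i j) (x-bit i _) (proj₂ (ẑ-bit i j nl tv)) (proj₂ penalties≡0)
      where
      row≡0 : ∑[ N.n ∣ N.treeV? ] (andPenalties i) ≡ 0ℤ
      row≡0 = to (∑[]≡0⇔ T.nonLeaf? λ i nl → ∑[]-nonneg N.treeV? (andPenalties-nonneg i nl))
                 (trans (sym P₈≡∑andPenalties) P₈≡0) i nl
      penalties≡0 : andPenalty (x i j) (x i (N.child₁ j)) (ẑ i (ev j)) ≡ 0ℤ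
                  × andPenalty (x i j) (x i (N.child₂ j)) (ẑ i (od j)) ≡ 0ℤ
      penalties≡0 = let p , q = penalties-nonneg i j nl tv in
        to (+≡0⇔ p q) (to (∑[]≡0⇔ N.treeV? (andPenalties-nonneg i nl)) row≡0 j tv)

    conflictTerm : Fin T.n → Fin T.n → Fin N.n → ℤ
    conflictTerm i l j = ẑ i (ev j) * x l (N.child₂ j) + ẑ i (od j) * x l (N.child₁ j)

    conflictTerm-summands-nonneg : ∀ {i l} → Edge T.adj i l → ∀ j → N.TreeV j →
      0ℤ ≤ ẑ i (ev j) * x l (N.child₂ j) × 0ℤ ≤ ẑ i (od j) * x l (N.child₁ j)
    conflictTerm-summands-nonneg {i} {l} e j tv =
      let ev-bit , od-bit = ẑ-bit i j (edge⇒nonLeaf e) tv in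
      bit-nonneg (bit-* ev-bit (x-bit l _)) , bit-nonneg (bit-* od-bit (x-bit l _))

    conflictTerm-nonneg : ∀ {i l} → Edge T.adj i l → ∀ j → N.TreeV j → 0ℤ ≤ conflictTerm i l j
    conflictTerm-nonneg e j tv = let p , q = conflictTerm-summands-nonneg e j tv in +-nonneg p q

    conflictTerm≡0⇔ : P₈ x ẑ ≡ 0ℤ → ∀ {i l j} → Edge T.adj i l → N.TreeV j →
                      conflictTerm i l j ≡ 0ℤ ⇔ (¬ Conflict x i l j)
    conflictTerm≡0⇔ P₈≡0 {i} {l} {j} e tv =
      let p , q     = conflictTerm-summands-nonneg e j tv
          ev≡ , od≡ = P₈≡0⇒ẑ≡* P₈≡0 (edge⇒nonLeaf e) tv
      in ⇔.trans (+≡0⇔ p q) (⇔.trans (product≡0⇔ ev≡ ×-⇔ product≡0⇔ od≡) ¬×¬⇔¬⊎)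
      where
      product≡0⇔ : ∀ {z b c} → z ≡ x i j * x i b → z * x l c ≡ 0ℤ ⇔
                   (¬ (d x i j × d x i b × d x l c))
      product≡0⇔ refl = bit-*-*≡0⇔ (x-bit i j) (x-bit i _) (x-bit l _)

    edgeTerm : Fin T.n → Fin T.n → ℤ
    edgeTerm i l = f i l * ∑[ N.n ∣ N.treeV? ] (conflictTerm i l)

    edgeTerm-nonneg : ∀ i l → 0ℤ ≤ edgeTerm i l
    edgeTerm-nonneg i l =
      indicator-*-nonneg (T.adj i l) λ e → ∑[]-nonneg N.treeV? (conflictTerm-nonneg e)

    P₉≡0⇔ : P₉ x ẑ ≡ 0ℤ ⇔ (∀ i l → Edge T.adj i l → ∀ j → N.TreeV j → conflictTerm i l j ≡ 0ℤ)
    P₉≡0⇔ = mk⇔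
      (λ P₉≡0 i l e → to (edge≡0⇔ e) (to (edgeTerm≡0⇔ i l)
        (to (row≡0⇔ i) (to (∑≡0⇔ T.n row-nonneg) P₉≡0 i) l (edge⇒≢ e)) e))
      (λ h → from (∑≡0⇔ T.n row-nonneg) λ i → from (row≡0⇔ i) λ l _ →
        from (edgeTerm≡0⇔ i l) λ e → from (edge≡0⇔ e) (h i l e))
      where
      ≢? : ∀ i l → Dec (l ≢ i)
      ≢? i l = ¬? (l ≟ᶠ i)
      row-nonneg : ∀ i → 0ℤ ≤ ∑[ T.n ∣ ≢? i ] (edgeTerm i)
      row-nonneg i = ∑[]-nonneg (≢? i) (λ l _ → edgeTerm-nonneg i l)
      row≡0⇔ : ∀ i → ∑[ T.n ∣ ≢? i ] (edgeTerm i) ≡ 0ℤ ⇔ (∀ l → l ≢ i → edgeTerm i l ≡ 0ℤ)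
      row≡0⇔ i = ∑[]≡0⇔ (≢? i) (λ l _ → edgeTerm-nonneg i l)
      edgeTerm≡0⇔ : ∀ i l → edgeTerm i l ≡ 0ℤ ⇔
                    (Edge T.adj i l → ∑[ N.n ∣ N.treeV? ] (conflictTerm i l) ≡ 0ℤ)
      edgeTerm≡0⇔ i l = indicator-*≡0⇔ (T.adj i l) _
      edge≡0⇔ : ∀ {i l} → Edge T.adj i l → ∑[ N.n ∣ N.treeV? ] (conflictTerm i l) ≡ 0ℤ ⇔
                (∀ j → N.TreeV j → conflictTerm i l j ≡ 0ℤ)
      edge≡0⇔ e = ∑[]≡0⇔ N.treeV? (conflictTerm-nonneg e)

lemma11 : {m : ℕ} (N : BinaryNetwork m) (T : BinaryTree m) →
  let module N = BinaryNetwork N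
      module T = BinaryTree T
      open Penalties N T
  in (x : Fin T.n → Fin N.n → ℤ) (ẑ : Fin T.n → ℕ → ℤ) →
     (∀ i j → Binary (x i j)) →
     (∀ i j → T.NonLeaf i → N.TreeV j → Binary (ẑ i (ev j)) × Binary (ẑ i (od j))) →
     P₈ x ẑ ≡ 0ℤ →
     (P₉ x ẑ ≡ 0ℤ ⇔
       (¬ (∃[ j ] ∃[ i ] ∃[ l ] (N.TreeV j × Edge T.adj i l ×
            ((d x i j × d x i (N.child₁ j) × d x l (N.child₂ j))
           ⊎ (d x i j × d x i (N.child₂ j) × d x l (N.child₁ j)))))))
lemma11 N T x ẑ x-bit ẑ-bit P₈≡0 = ⇔.trans (P₉≡0⇔ N T x ẑ x-bit ẑ-bit) (mk⇔
  (λ allZero (j , i , l , tv , e , conflict) →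
     to (conflictTerm≡0⇔ N T x ẑ x-bit ẑ-bit P₈≡0 e tv) (allZero i l e j tv) conflict)
  (λ noConflict i l e j tv →
     from (conflictTerm≡0⇔ N T x ẑ x-bit ẑ-bit P₈≡0 e tv)
       λ conflict → noConflict (j , i , l , tv , e , conflict)))
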